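{- Let $P_1=(1,2,3)$, $P_2=(2,3,1)$, $P_3=(1,3,2)$. For each $i\in\{1,2,3\}$ and every $n$, $\mathsf{gex}(n,P_i)=\mathsf{gex}(n,P_i^{flip})$.
   Context: For a permutation (or point set) $M$ with $n$ columns, $M^{flip}$ is its reflection about a vertical axis: $M^{flip}(i,j)=M(n-i+1,j)$; for sequences this replaces each value $v$ by $n+1-v$, so $P_1^{flip}=(3,2,1)$, $P_2^{flip}=(2,1,3)$, $P_3^{flip}=(3,1,2)$. A sequence avoids a pattern $\pi$ if it has no subsequence order-isomorphic to $\pi$. $\mathsf{gex}(n,P)$ is the maximum of $|G_T(X)|$ over all permutations $X$ of $[n]$ avoiding $P$ and all initial binary search trees $T$ on $[n]$, where $G_T(X)$ is the geometric Greedy execution: the initial tree is encoded by a fixed point set in rows $-(n-1),\dots,0$ (standard geometric encoding); for $t=1,\dots,n$, with $p=(x_t,t)$ and, for each key $a$, $q=(a,\tau(a,t))$ where $\tau(a,t)$ is the last row $<t$ with a point in column $a$, the point $(a,t)$ is added iff the closed rectangle with corners $p,q$ contains no other point; $G_T(X)$ is the set of points added in rows $1,\dots,n$. -}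

module Defs where

open import Data.Nat as ℕ using (ℕ; zero; suc; _∸_; _<_; _≤_)
open import Data.Integer as ℤ using (ℤ; +_; -_)
open import Data.Bool using (Bool; true; false; _∧_; _∨_; not; if_then_else_)
open import Data.List using (List; []; _∷_; _++_; map; filter; length; upTo; foldr)
open import Data.List.Relation.Binary.Sublist.Propositional using (_⊆_)
open import Data.List.Relation.Binary.Permutation.Propositional using (_↭_)
open import Data.List.Relation.Binary.Pointwise using (Pointwise)
open import Data.Maybe using (Maybe; just; nothing)
open import Data.Product using (_×_; _,_; ∃; ∃-syntax)
open import Relation.Nullary using (¬_)
open import Function.Bundles using (_⇔_)
open import Relation.Binary.PropositionalEquality using (_≡_)

range1 : ℕ → List ℕ
range1 n = map suc (upTo n)

IsPermOf : ℕ → List ℕ → Set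
IsPermOf n X = X ↭ range1 n

data OrderIso : List ℕ → List ℕ → Set where
  []  : OrderIso [] []
  _∷_ : ∀ {x y xs ys} →
        Pointwise (λ x′ y′ → ((x < x′) ⇔ (y < y′)) × ((x′ < x) ⇔ (y′ < y))) xs ys →
        OrderIso xs ys → OrderIso (x ∷ xs) (y ∷ ys)

Contains : List ℕ → List ℕ → Set
Contains X π = ∃[ ys ] (ys ⊆ X × OrderIso ys π)

Avoids : List ℕ → List ℕ → Set
Avoids X π = ¬ Contains X π

flipSeq : List ℕ → List ℕ
flipSeq π = map (λ v → suc (length π) ∸ v) π

P₁ P₂ P₃ : List ℕ
P₁ = 1 ∷ 2 ∷ 3 ∷ []
P₂ = 2 ∷ 3 ∷ 1 ∷ []
P₃ = 1 ∷ 3 ∷ 2 ∷ []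

data Tree : Set where
  leaf : Tree
  node : Tree → ℕ → Tree → Tree

inorder : Tree → List ℕ
inorder leaf = []
inorder (node l k r) = inorder l ++ (k ∷ inorder r)

IsBSTOn : ℕ → Tree → Set
IsBSTOn n T = inorder T ≡ range1 n

-- Geometric view.  A point is (column , row), rows are integers.

Point : Set
Point = ℕ × ℤ

-- standard encoding of the initial tree: key a at (a , - depth_T(a)),
-- the root having depth 0 (so rows lie in -(n-1) .. 0)
initPtsD : ℕ → Tree → List Point
initPtsD d leaf = []
initPtsD d (node l k r) = (k , - (+ d)) ∷ (initPtsD (suc d) l ++ initPtsD (suc d) r)

initPts : Tree → List Point
initPts = initPtsD 0

allB : {A : Set} → (A → Bool) → List A → Bool
allB p [] = true
allB p (x ∷ xs) = p x ∧ allB p xs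

maxRow : Maybe ℤ → ℤ → Maybe ℤ
maxRow nothing r = just r
maxRow (just s) r = just (s ℤ.⊔ r)

lastRow : List Point → ℕ → Maybe ℤ
lastRow [] a = nothing
lastRow ((b , r) ∷ ps) a =
  if b ℕ.≡ᵇ a then maxRow (lastRow ps a) r else lastRow ps a

inRect : ℕ → ℤ → ℕ → ℤ → Point → Bool
inRect x t a s (b , r) =
  ((x ℕ.⊓ a) ℕ.≤ᵇ b) ∧ (b ℕ.≤ᵇ (x ℕ.⊔ a)) ∧
  ((s ℤ.⊓ t) ℤ.≤ᵇ r) ∧ (r ℤ.≤ᵇ (s ℤ.⊔ t))

-- the closed rectangle with corners p = (x , t) and q = (a , s) contains no
-- point of ps other than p and q
emptyRect : List Point → ℕ → ℤ → ℕ → ℤ → Bool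
emptyRect ps x t a s =
  allB (λ pt → not (inRect x t a s pt)
              ∨ ((Data.Product.proj₁ pt ℕ.≡ᵇ a) ∧ (Data.Product.proj₂ pt ℤ.≤ᵇ s) ∧ (s ℤ.≤ᵇ Data.Product.proj₂ pt))
              ∨ ((Data.Product.proj₁ pt ℕ.≡ᵇ x) ∧ (Data.Product.proj₂ pt ℤ.≤ᵇ t) ∧ (t ℤ.≤ᵇ Data.Product.proj₂ pt)))
      ps

-- Greedy decision for key a at time t with access x, given all points in rows < t
touch : List Point → ℕ → ℤ → ℕ → Bool
touch ps x t a with lastRow ps a
... | nothing = false
... | just s  = emptyRect ps x t a s

stepPts : ℕ → List Point → ℕ → ℤ → List Point
stepPts n ps x t = map (λ a → (a , t)) (filter (λ a → Data.Bool.T? (touch ps x t a)) (range1 n))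

runGreedy : ℕ → List Point → ℕ → List ℕ → List Point
runGreedy n ps t [] = []
runGreedy n ps t (x ∷ xs) =
  stepPts n ps x (+ t) ++ runGreedy n (ps ++ stepPts n ps x (+ t)) (suc t) xs

-- G_T(X): the points added in rows 1..n (one per touched key and row,
-- hence without repetition)
G : ℕ → Tree → List ℕ → List Point
G n T X = runGreedy n (initPts T) 1 X

Attained : ℕ → List ℕ → ℕ → Set
Attained n P m = ∃[ X ] ∃[ T ] (IsPermOf n X × Avoids X P × IsBSTOn n T × length (G n T X) ≡ m)

IsGex : ℕ → List ℕ → ℕ → Set
IsGex n P g = Attained n P g × (∀ m → Attained n P m → m ≤ g)

-- Reflecting the keys by a ↦ n + 1 ∸ a maps a P-avoiding permutation X of [n] to a
-- flip P-avoiding one and a search tree T on [n] to its mirror image.  Greedy commutes with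
-- this reflection: a key is touched according to which points lie in an axis-parallel
-- rectangle, and reflecting the columns maps such rectangles onto each other.  So the
-- mirrored execution consists of the mirrored points, and P and flip P attain the same
-- values of |G_T(X)|.  These values form a finite set, nonempty because each Pᵢ starts with
-- an ascent and is therefore avoided by the decreasing permutation; so they have a common
-- maximum.

module Submission where

open import Defs
open import Data.Bool using (Bool; true; false; _∧_; T?)
open import Data.Bool.Properties using (∧-assoc; ∧-comm)
import Data.Integer as ℤ
import Data.Integer.Properties as ℤ
open import Data.List using (List; []; _∷_; _++_; map; filter; length; upTo; applyUpTo; downFrom; reverse; [_]; cartesianProduct; cartesianProductWith)
import Data.List.Properties as List
open import Data.List.Extrema.Nat using (argmax; argmax-all; f[xs]≤f[argmax])
open import Data.List.Membership.Propositional using (_∈_; lose)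
import Data.List.Membership.Propositional.Properties as ∈
open import Data.List.Relation.Binary.Permutation.Propositional using (_↭_; ↭-sym; ↭-trans; ↭-reflexive; ↭-refl; prep; swap; module PermutationReasoning)
import Data.List.Relation.Binary.Permutation.Propositional as ↭
import Data.List.Relation.Binary.Permutation.Propositional.Properties as ↭
open import Data.List.Relation.Binary.Pointwise using (Pointwise; []; _∷_)
import Data.List.Relation.Binary.Pointwise.Properties as Pointwise
open import Data.List.Relation.Binary.Sublist.Propositional using (_⊆_; []; _∷_; _∷ʳ_)
import Data.List.Relation.Binary.Sublist.Propositional.Properties as Sublist
open import Data.List.Relation.Unary.All as All using (All; []; _∷_)
import Data.List.Relation.Unary.All.Properties as All
open import Data.List.Relation.Unary.Any as Any using (Any; here; there)
open import Data.List.Relation.Unary.AllPairs using (AllPairs; []; _∷_)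
open import Data.Maybe using (just; nothing)
open import Data.Nat as ℕ using (ℕ; zero; suc; _∸_; _≤_; _<_; z≤n; s≤s; _⊔_; _⊓_)
import Data.Nat.Properties as ℕ
open import Data.List.Relation.Binary.Sublist.DecPropositional ℕ._≟_ using (_⊆?_)
open import Data.Product using (_×_; _,_; ∃-syntax; proj₁; proj₂; uncurry)
open import Function using (_∘_; case_of_)
open import Function.Bundles using (_⇔_; mk⇔; Equivalence)
import Function.Properties.Equivalence as ⇔
open import Relation.Nullary using (Dec; yes; no)
open import Relation.Nullary.Decidable as Dec using (does-⇔; from-yes; _×-dec_; _→-dec_)
import Relation.Unary as U
open import Relation.Binary using (DecidableEquality)
open import Relation.Binary.PropositionalEquality using (_≡_; refl; sym; trans; cong; cong₂; subst; subst₂; module ≡-Reasoning)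

∸-reverses-< : ∀ c {x y} → x ≤ c → (c ∸ x < c ∸ y) ⇔ (y < x)
∸-reverses-< c x≤c = mk⇔
  (λ lt → ℕ.≰⇒> (λ x≤y → ℕ.<⇒≱ lt (ℕ.∸-monoʳ-≤ c x≤y)))
  (λ y<x → ℕ.∸-monoʳ-< y<x x≤c)

module _ (c d : ℕ) where

  ∸-preserves-OrderIso : ∀ {xs ys} → All (_≤ c) xs → All (_≤ d) ys →
    OrderIso xs ys → OrderIso (map (c ∸_) xs) (map (d ∸_) ys)
  ∸-preserves-OrderIso [] [] [] = []
  ∸-preserves-OrderIso {x ∷ _} {y ∷ _} (x≤c ∷ xs≤c) (y≤d ∷ ys≤d) (rel ∷ iso) =
    pointwise xs≤c ys≤d rel ∷ ∸-preserves-OrderIso xs≤c ys≤d iso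
    where
      reverse-⇔ : ∀ {u u′ v v′} → u ≤ c → u′ ≤ c → v ≤ d → v′ ≤ d →
        (u′ < u) ⇔ (v′ < v) → (c ∸ u < c ∸ u′) ⇔ (d ∸ v < d ∸ v′)
      reverse-⇔ u≤c u′≤c v≤d v′≤d e =
        ⇔.trans (∸-reverses-< c u≤c) (⇔.trans e (⇔.sym (∸-reverses-< d v≤d)))
      pointwise : ∀ {xs′ ys′} → All (_≤ c) xs′ → All (_≤ d) ys′ →
        Pointwise (λ x′ y′ → ((x < x′) ⇔ (y < y′)) × ((x′ < x) ⇔ (y′ < y))) xs′ ys′ →
        Pointwise (λ x′ y′ → ((c ∸ x < x′) ⇔ (d ∸ y < y′)) × ((x′ < c ∸ x) ⇔ (y′ < d ∸ y)))
          (map (c ∸_) xs′) (map (d ∸_) ys′)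
      pointwise [] [] [] = []
      pointwise (x′≤c ∷ p) (y′≤d ∷ q) ((lt , gt) ∷ rs) =
        (reverse-⇔ x≤c x′≤c y≤d y′≤d gt , reverse-⇔ x′≤c x≤c y′≤d y≤d lt) ∷ pointwise p q rs

∧-swap : ∀ a b c → a ∧ (b ∧ c) ≡ b ∧ (a ∧ c)
∧-swap a b c = trans (sym (∧-assoc a b c)) (trans (cong (_∧ c) (∧-comm a b)) (∧-assoc b a c))

allB-↭ : ∀ {A : Set} (f : A → Bool) {xs ys} → xs ↭ ys → allB f xs ≡ allB f ys
allB-↭ f ↭.refl = refl
allB-↭ f (prep x p) = cong (f x ∧_) (allB-↭ f p)
allB-↭ f (swap x y p) rewrite allB-↭ f p = ∧-swap (f x) (f y) _
allB-↭ f (↭.trans p q) = trans (allB-↭ f p) (allB-↭ f q)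

module _ {A B : Set} (P : B → Bool) (f : A → B) where

  filter-map : ∀ xs → filter (T? ∘ P) (map f xs) ≡ map f (filter (T? ∘ P ∘ f) xs)
  filter-map [] = refl
  filter-map (x ∷ xs) with P (f x)
  ... | true = cong (f x ∷_) (filter-map xs)
  ... | false = filter-map xs

filter-cong : ∀ {A : Set} {P Q : A → Bool} {xs} → All (λ x → P x ≡ Q x) xs →
  filter (T? ∘ P) xs ≡ filter (T? ∘ Q) xs
filter-cong [] = refl
filter-cong {Q = Q} {x ∷ _} (eq ∷ eqs) rewrite eq with Q x
... | true = cong (x ∷_) (filter-cong eqs)
... | false = filter-cong eqs

maxRow-comm : ∀ m r r′ → maxRow (maxRow m r) r′ ≡ maxRow (maxRow m r′) r
maxRow-comm nothing r r′ = cong just (ℤ.⊔-comm r r′)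
maxRow-comm (just s) r r′ = cong just (begin
  s ℤ.⊔ r ℤ.⊔ r′   ≡⟨ ℤ.⊔-assoc s r r′ ⟩
  s ℤ.⊔ (r ℤ.⊔ r′) ≡⟨ cong (s ℤ.⊔_) (ℤ.⊔-comm r r′) ⟩
  s ℤ.⊔ (r′ ℤ.⊔ r) ≡⟨ sym (ℤ.⊔-assoc s r′ r) ⟩
  s ℤ.⊔ r′ ℤ.⊔ r   ∎)
  where open ≡-Reasoning

lastRow-↭ : ∀ {ps qs} a → ps ↭ qs → lastRow ps a ≡ lastRow qs a
lastRow-↭ a ↭.refl = refl
lastRow-↭ a (prep (b , r) p) rewrite lastRow-↭ a p = refl
lastRow-↭ {(b , r) ∷ (b′ , r′) ∷ _} a (swap _ _ p) rewrite lastRow-↭ a p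
  with b ℕ.≡ᵇ a | b′ ℕ.≡ᵇ a
... | true  | true  = maxRow-comm _ r′ r
... | true  | false = refl
... | false | true  = refl
... | false | false = refl
lastRow-↭ a (↭.trans p q) = trans (lastRow-↭ a p) (lastRow-↭ a q)

touch-↭ : ∀ {ps qs} x t a → ps ↭ qs → touch ps x t a ≡ touch qs x t a
touch-↭ {ps} {qs} x t a p rewrite lastRow-↭ a p with lastRow qs a
... | nothing = refl
... | just s = allB-↭ _ p

map-∸-upTo : ∀ m → map (m ∸_) (upTo m) ≡ map suc (downFrom m)
map-∸-upTo zero = refl
map-∸-upTo (suc m) = cong (suc m ∷_) (begin
  map (suc m ∸_) (applyUpTo suc m) ≡⟨ List.map-applyUpTo suc (suc m ∸_) m ⟩
  applyUpTo (m ∸_) m               ≡⟨ sym (List.map-upTo (m ∸_) m) ⟩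
  map (m ∸_) (upTo m)              ≡⟨ map-∸-upTo m ⟩
  map suc (downFrom m)             ∎)
  where open ≡-Reasoning

keys-initPtsD : ∀ d T → map proj₁ (initPtsD d T) ↭ inorder T
keys-initPtsD d leaf = ↭-refl
keys-initPtsD d (node l k r) = begin
  k ∷ map proj₁ (initPtsD (suc d) l ++ initPtsD (suc d) r)
    ≡⟨ cong (k ∷_) (List.map-++ proj₁ (initPtsD (suc d) l) _) ⟩
  k ∷ map proj₁ (initPtsD (suc d) l) ++ map proj₁ (initPtsD (suc d) r)
    ↭⟨ prep k (↭.++⁺ (keys-initPtsD (suc d) l) (keys-initPtsD (suc d) r)) ⟩
  k ∷ inorder l ++ inorder r
    ↭⟨ ↭.shift k (inorder l) (inorder r) ⟨
  inorder l ++ k ∷ inorder r ∎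
  where open PermutationReasoning

module Mirror (n : ℕ) where

  mir : ℕ → ℕ
  mir a = suc n ∸ a

  mirP : Point → Point
  mirP (b , r) = mir b , r

  BoundedPts : List Point → Set
  BoundedPts = All (λ p → proj₁ p ≤ n)

  mir-involutive : ∀ {a} → a ≤ suc n → mir (mir a) ≡ a
  mir-involutive = ℕ.m∸[m∸n]≡n

  mir-injective : ∀ {a b} → a ≤ suc n → b ≤ suc n → mir a ≡ mir b → a ≡ b
  mir-injective a≤ b≤ eq = trans (sym (mir-involutive a≤)) (trans (cong mir eq) (mir-involutive b≤))

  mir-≤ᵇ : ∀ {u v} → u ≤ suc n → v ≤ suc n → (mir u ℕ.≤ᵇ mir v) ≡ (v ℕ.≤ᵇ u)
  mir-≤ᵇ {u} {v} u≤ v≤ = does-⇔ (mk⇔ to (ℕ.∸-monoʳ-≤ (suc n))) (mir u ℕ.≤? mir v) (v ℕ.≤? u)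
    where
      to : mir u ≤ mir v → v ≤ u
      to le = subst₂ _≤_ (mir-involutive v≤) (mir-involutive u≤) (ℕ.∸-monoʳ-≤ (suc n) le)

  mir-≡ᵇ : ∀ {u v} → u ≤ suc n → v ≤ suc n → (mir u ℕ.≡ᵇ mir v) ≡ (u ℕ.≡ᵇ v)
  mir-≡ᵇ {u} {v} u≤ v≤ = does-⇔ (mk⇔ (mir-injective u≤ v≤) (cong mir)) (mir u ℕ.≟ mir v) (u ℕ.≟ v)

  inRect-mir : ∀ x t a s b r → x ≤ suc n → a ≤ suc n → b ≤ suc n →
    inRect (mir x) t (mir a) s (mir b , r) ≡ inRect x t a s (b , r)
  inRect-mir x t a s b r x≤ a≤ b≤
    rewrite sym (ℕ.∸-distribˡ-⊔-⊓ (suc n) x a) | sym (ℕ.∸-distribˡ-⊓-⊔ (suc n) x a)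
          | mir-≤ᵇ {x ⊔ a} {b} (ℕ.⊔-lub x≤ a≤) b≤ | mir-≤ᵇ {b} {x ⊓ a} b≤ (ℕ.m≤n⇒m⊓o≤n a x≤)
    = ∧-swap (b ℕ.≤ᵇ x ⊔ a) (x ⊓ a ℕ.≤ᵇ b) _

  emptyRect-mir : ∀ {ps} x t a s → BoundedPts ps → x ≤ n → a ≤ n →
    emptyRect (map mirP ps) (mir x) t (mir a) s ≡ emptyRect ps x t a s
  emptyRect-mir x t a s [] x≤ a≤ = refl
  emptyRect-mir {(b , r) ∷ _} x t a s (b≤ ∷ bounded) x≤ a≤
    rewrite inRect-mir x t a s b r (ℕ.m≤n⇒m≤1+n x≤) (ℕ.m≤n⇒m≤1+n a≤) (ℕ.m≤n⇒m≤1+n b≤)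
          | mir-≡ᵇ (ℕ.m≤n⇒m≤1+n b≤) (ℕ.m≤n⇒m≤1+n a≤) | mir-≡ᵇ (ℕ.m≤n⇒m≤1+n b≤) (ℕ.m≤n⇒m≤1+n x≤)
          | emptyRect-mir x t a s bounded x≤ a≤
    = refl

  lastRow-mir : ∀ {ps} a → BoundedPts ps → a ≤ n → lastRow (map mirP ps) (mir a) ≡ lastRow ps a
  lastRow-mir a [] a≤ = refl
  lastRow-mir a (b≤ ∷ bounded) a≤
    rewrite mir-≡ᵇ (ℕ.m≤n⇒m≤1+n b≤) (ℕ.m≤n⇒m≤1+n a≤) | lastRow-mir a bounded a≤ = refl

  touch-mir : ∀ {ps} x t a → BoundedPts ps → x ≤ n → a ≤ n →
    touch (map mirP ps) (mir x) t (mir a) ≡ touch ps x t a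
  touch-mir {ps} x t a bounded x≤ a≤ rewrite lastRow-mir a bounded a≤ with lastRow ps a
  ... | nothing = refl
  ... | just s = emptyRect-mir x t a s bounded x≤ a≤

  range1-bounded : All (_≤ n) (range1 n)
  range1-bounded = All.map⁺ (All.applyUpTo⁺₁ (λ i → i) n (λ i<n → i<n))

  map-mir-range1 : map mir (range1 n) ≡ reverse (range1 n)
  map-mir-range1 = begin
    map mir (map suc (upTo n))   ≡⟨ sym (List.map-∘ (upTo n)) ⟩
    map (n ∸_) (upTo n)          ≡⟨ map-∸-upTo n ⟩
    map suc (downFrom n)         ≡⟨ cong (map suc) (sym (List.reverse-upTo n)) ⟩
    map suc (reverse (upTo n))   ≡⟨ List.reverse-map suc (upTo n) ⟩
    reverse (range1 n)           ∎
    where open ≡-Reasoning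

  map-mir-range1-↭ : map mir (range1 n) ↭ range1 n
  map-mir-range1-↭ = subst (_↭ range1 n) (sym map-mir-range1) (↭.↭-reverse (range1 n))

  stepPts-bounded : ∀ ps x t → BoundedPts (stepPts n ps x t)
  stepPts-bounded ps x t = All.map⁺ (All.filter⁺ _ range1-bounded)

  -- A row lists its touched keys in increasing column order, so the mirrored execution
  -- is the mirror image of the original one only up to the order of its points.
  stepPts-mir : ∀ {ps qs} x t → qs ↭ map mirP ps → BoundedPts ps → x ≤ n →
    stepPts n qs (mir x) t ↭ map mirP (stepPts n ps x t)
  stepPts-mir {ps} {qs} x t qs↭ bounded x≤ = begin
    map (_, t) (filter (T? ∘ touch qs (mir x) t) (range1 n))
      ≡⟨ cong (map (_, t)) (filter-cong (All.tabulate {xs = range1 n} (λ {a} _ →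
           touch-↭ (mir x) t a qs↭))) ⟩
    map (_, t) (filter (T? ∘ touchMir) (range1 n))
      ↭⟨ ↭.map⁺ (_, t) (↭.filter-↭ (T? ∘ touchMir) (↭-sym map-mir-range1-↭)) ⟩
    map (_, t) (filter (T? ∘ touchMir) (map mir (range1 n)))
      ≡⟨ cong (map (_, t)) (filter-map touchMir mir (range1 n)) ⟩
    map (_, t) (map mir (filter (T? ∘ touchMir ∘ mir) (range1 n)))
      ≡⟨ cong (map (_, t) ∘ map mir) (filter-cong (All.map (λ a≤ →
           touch-mir x t _ bounded x≤ a≤) range1-bounded)) ⟩
    map (_, t) (map mir (filter (T? ∘ touch ps x t) (range1 n)))
      ≡⟨ trans (sym (List.map-∘ touched)) (List.map-∘ touched) ⟩
    map mirP (map (_, t) (filter (T? ∘ touch ps x t) (range1 n))) ∎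
    where
      open PermutationReasoning
      touchMir : ℕ → Bool
      touchMir = touch (map mirP ps) (mir x) t
      touched : List ℕ
      touched = filter (T? ∘ touch ps x t) (range1 n)

  runGreedy-mir : ∀ {ps qs} t xs → qs ↭ map mirP ps → BoundedPts ps → All (_≤ n) xs →
    runGreedy n qs t (map mir xs) ↭ map mirP (runGreedy n ps t xs)
  runGreedy-mir t [] qs↭ bounded xs≤ = ↭-refl
  runGreedy-mir {ps} {qs} t (x ∷ xs) qs↭ bounded (x≤ ∷ xs≤) = begin
    stepQ ++ runGreedy n (qs ++ stepQ) (suc t) (map mir xs)
      ↭⟨ ↭.++⁺ step↭ (runGreedy-mir (suc t) xs next↭
           (All.++⁺ bounded (stepPts-bounded ps x _)) xs≤) ⟩
    map mirP stepP ++ map mirP (runGreedy n (ps ++ stepP) (suc t) xs)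
      ≡⟨ sym (List.map-++ mirP stepP _) ⟩
    map mirP (stepP ++ runGreedy n (ps ++ stepP) (suc t) xs) ∎
    where
      open PermutationReasoning
      stepP = stepPts n ps x (ℤ.+ t)
      stepQ = stepPts n qs (mir x) (ℤ.+ t)
      step↭ : stepQ ↭ map mirP stepP
      step↭ = stepPts-mir x (ℤ.+ t) qs↭ bounded x≤
      next↭ : qs ++ stepQ ↭ map mirP (ps ++ stepP)
      next↭ = ↭-trans (↭.++⁺ qs↭ step↭) (↭-reflexive (sym (List.map-++ mirP ps stepP)))

  map-mir-bounded : ∀ xs → All (_≤ suc n) (map mir xs)
  map-mir-bounded xs = All.map⁺ (All.universal (ℕ.m∸n≤m (suc n)) xs)

  map-mir-involutive : ∀ {xs} → All (_≤ suc n) xs → map mir (map mir xs) ≡ xs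
  map-mir-involutive {xs} xs≤ =
    trans (sym (List.map-∘ xs)) (List.map-id-local (All.map mir-involutive xs≤))

  mirT : Tree → Tree
  mirT leaf = leaf
  mirT (node l k r) = node (mirT r) (mir k) (mirT l)

  inorder-mirT : ∀ T → inorder (mirT T) ≡ reverse (map mir (inorder T))
  inorder-mirT leaf = refl
  inorder-mirT (node l k r) = begin
    inorder (mirT r) ++ mir k ∷ inorder (mirT l)
      ≡⟨ cong₂ (λ u v → u ++ mir k ∷ v) (inorder-mirT r) (inorder-mirT l) ⟩
    reverse (map mir (inorder r)) ++ [ mir k ] ++ reverse (map mir (inorder l))
      ≡⟨ sym (List.++-assoc (reverse (map mir (inorder r))) [ mir k ] _) ⟩
    (reverse (map mir (inorder r)) ++ [ mir k ]) ++ reverse (map mir (inorder l))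
      ≡⟨ cong (_++ reverse (map mir (inorder l)))
              (sym (List.unfold-reverse (mir k) (map mir (inorder r)))) ⟩
    reverse (mir k ∷ map mir (inorder r)) ++ reverse (map mir (inorder l))
      ≡⟨ sym (List.reverse-++ (map mir (inorder l)) (mir k ∷ map mir (inorder r))) ⟩
    reverse (map mir (inorder l) ++ mir k ∷ map mir (inorder r))
      ≡⟨ cong reverse (sym (List.map-++ mir (inorder l) (k ∷ inorder r))) ⟩
    reverse (map mir (inorder l ++ k ∷ inorder r)) ∎
    where open ≡-Reasoning

  mirT-IsBSTOn : ∀ T → IsBSTOn n T → IsBSTOn n (mirT T)
  mirT-IsBSTOn T bst = begin
    inorder (mirT T)                  ≡⟨ inorder-mirT T ⟩
    reverse (map mir (inorder T))     ≡⟨ cong (reverse ∘ map mir) bst ⟩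
    reverse (map mir (range1 n))      ≡⟨ cong reverse map-mir-range1 ⟩
    reverse (reverse (range1 n))      ≡⟨ List.reverse-involutive (range1 n) ⟩
    range1 n                          ∎
    where open ≡-Reasoning

  initPtsD-mirT : ∀ d T → initPtsD d (mirT T) ↭ map mirP (initPtsD d T)
  initPtsD-mirT d leaf = ↭-refl
  initPtsD-mirT d (node l k r) = prep _ (begin
    initPtsD (suc d) (mirT r) ++ initPtsD (suc d) (mirT l)
      ↭⟨ ↭.++⁺ (initPtsD-mirT (suc d) r) (initPtsD-mirT (suc d) l) ⟩
    map mirP (initPtsD (suc d) r) ++ map mirP (initPtsD (suc d) l)
      ↭⟨ ↭.++-comm (map mirP (initPtsD (suc d) r)) _ ⟩
    map mirP (initPtsD (suc d) l) ++ map mirP (initPtsD (suc d) r)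
      ≡⟨ sym (List.map-++ mirP (initPtsD (suc d) l) _) ⟩
    map mirP (initPtsD (suc d) l ++ initPtsD (suc d) r) ∎)
    where open PermutationReasoning

  initPts-bounded : ∀ {T} → IsBSTOn n T → BoundedPts (initPts T)
  initPts-bounded {T} bst =
    All.map⁻ (↭.All-resp-↭ (↭-sym (keys-initPtsD 0 T))
      (subst (All (_≤ n)) (sym bst) range1-bounded))

  G-mir : ∀ T {X} → IsBSTOn n T → All (_≤ n) X →
    G n (mirT T) (map mir X) ↭ map mirP (G n T X)
  G-mir T {X} bst X≤ = runGreedy-mir 1 X (initPtsD-mirT 0 T) (initPts-bounded bst) X≤

  Contains-mir : ∀ {X R} → All (_≤ suc n) X → All (_≤ suc (length R)) R →
    Contains (map mir X) R → Contains X (flipSeq R)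
  Contains-mir {X} {R} X≤ R≤ (ys , ys⊆ , iso) =
    map mir ys ,
    subst (map mir ys ⊆_) (map-mir-involutive X≤) (Sublist.map⁺ mir ys⊆) ,
    ∸-preserves-OrderIso (suc n) (suc (length R))
      (Sublist.All-resp-⊆ ys⊆ (map-mir-bounded X)) R≤ iso

  Attained-flip : ∀ {R m} → All (_≤ suc (length R)) R → Attained n (flipSeq R) m → Attained n R m
  Attained-flip {R} R≤ (X , T , perm , avoids , bst , size) =
    map mir X , mirT T ,
    ↭-trans (↭.map⁺ mir perm) map-mir-range1-↭ ,
    avoids ∘ Contains-mir (All.map ℕ.m≤n⇒m≤1+n X≤) R≤ ,
    mirT-IsBSTOn T bst ,
    trans (↭.↭-length (G-mir T bst X≤)) (trans (List.length-map mirP (G n T X)) size)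
    where
      X≤ : All (_≤ n) X
      X≤ = ↭.All-resp-↭ (↭-sym perm) range1-bounded

module _ {A : Set} {Q : A → Set} (Q? : U.Decidable Q) (f : A → ℕ) where

  argmax-exists : ∀ xs → (∀ {a} → Q a → a ∈ xs) → ∀ {a₀} → Q a₀ →
    ∃[ a ] (Q a × (∀ {b} → Q b → f b ≤ f a))
  argmax-exists xs complete {a₀} q₀ =
    argmax f a₀ (filter Q? xs) ,
    argmax-all f q₀ (All.all-filter Q? xs) ,
    λ qb → All.lookup (f[xs]≤f[argmax] a₀ (filter Q? xs)) (∈.∈-filter⁺ Q? (complete qb) qb)

module _ {A : Set} (_≟_ : DecidableEquality A) where
  open import Data.List.Membership.DecPropositional _≟_ using (_∈?_)

  ↭-dec : (xs ys : List A) → Dec (xs ↭ ys)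
  ↭-dec [] [] = yes ↭-refl
  ↭-dec [] (y ∷ ys) = no (λ p → case ↭.↭-empty-inv (↭-sym p) of λ ())
  ↭-dec (x ∷ xs) ys with x ∈? ys
  ... | no x∉ys = no (λ p → x∉ys (↭.∈-resp-↭ p (here refl)))
  ... | yes x∈ys with ∈.∈-∃++ x∈ys
  ... | us , vs , refl with ↭-dec xs (us ++ vs)
  ...   | yes p = yes (↭-trans (prep x p) (↭-sym (↭.shift x us vs)))
  ...   | no ¬p = no (λ p → ¬p (↭.drop-mid [] us p))

listsOfLength : ∀ {A : Set} → ℕ → List A → List (List A)
listsOfLength zero K = [] ∷ []
listsOfLength (suc k) K = cartesianProductWith _∷_ K (listsOfLength k K)

listsOfLength-complete : ∀ {A : Set} {K : List A} xs → All (_∈ K) xs →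
  xs ∈ listsOfLength (length xs) K
listsOfLength-complete [] [] = here refl
listsOfLength-complete (x ∷ xs) (x∈ ∷ xs∈) =
  ∈.∈-cartesianProductWith⁺ _∷_ x∈ (listsOfLength-complete xs xs∈)

⇔-dec : ∀ {P Q : Set} → Dec P → Dec Q → Dec (P ⇔ Q)
⇔-dec P? Q? = Dec.map′ (uncurry mk⇔) (λ e → Equivalence.to e , Equivalence.from e)
  ((P? →-dec Q?) ×-dec (Q? →-dec P?))

OrderIso-length : ∀ {xs ys} → OrderIso xs ys → length xs ≡ length ys
OrderIso-length [] = refl
OrderIso-length (_ ∷ iso) = cong suc (OrderIso-length iso)

OrderIso-dec : ∀ xs ys → Dec (OrderIso xs ys)
OrderIso-dec [] [] = yes []
OrderIso-dec [] (y ∷ ys) = no (λ ())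
OrderIso-dec (x ∷ xs) [] = no (λ ())
OrderIso-dec (x ∷ xs) (y ∷ ys) =
  Dec.map′ (uncurry _∷_) (λ { (rel ∷ iso) → rel , iso }) (relations? ×-dec OrderIso-dec xs ys)
  where
    relations? = Pointwise.decidable
      (λ x′ y′ → ⇔-dec (x ℕ.<? x′) (y ℕ.<? y′) ×-dec ⇔-dec (x′ ℕ.<? x) (y′ ℕ.<? y)) xs ys

Contains-dec : ∀ X P → Dec (Contains X P)
Contains-dec X P = Dec.map′ found found⁻¹ (Any.any? candidate? (listsOfLength (length P) X))
  where
    candidate? = λ ys → (ys ⊆? X) ×-dec OrderIso-dec ys P
    found : Any (λ ys → ys ⊆ X × OrderIso ys P) (listsOfLength (length P) X) → Contains X P
    found any = Any.satisfied any
    found⁻¹ : Contains X P → Any (λ ys → ys ⊆ X × OrderIso ys P) (listsOfLength (length P) X)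
    found⁻¹ (ys , ys⊆ , iso) = lose (subst (λ k → ys ∈ listsOfLength k X) (OrderIso-length iso)
      (listsOfLength-complete ys (Sublist.All-resp-⊆ ys⊆ (All.tabulate (λ x∈ → x∈))))) (ys⊆ , iso)

length-range1 : ∀ n → length (range1 n) ≡ n
length-range1 n = trans (List.length-map suc (upTo n)) (List.length-upTo n)

height : Tree → ℕ
height leaf = 0
height (node l k r) = suc (height l ⊔ height r)

height≤size : ∀ T → height T ≤ length (inorder T)
height≤size leaf = z≤n
height≤size (node l k r) = subst (suc (height l ⊔ height r) ≤_) (sym size)
  (s≤s (ℕ.⊔-lub (ℕ.≤-trans (height≤size l) (ℕ.m≤m+n _ _))
                 (ℕ.≤-trans (height≤size r) (ℕ.m≤n+m _ _))))
  where
    size : length (inorder l ++ k ∷ inorder r) ≡ suc (length (inorder l) ℕ.+ length (inorder r))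
    size = trans (List.length-++ (inorder l)) (ℕ.+-suc _ _)

treesOfHeight≤ : ℕ → List ℕ → List Tree
treesOfHeight≤ zero K = leaf ∷ []
treesOfHeight≤ (suc h) K =
  leaf ∷ cartesianProductWith (λ l kr → node l (proj₁ kr) (proj₂ kr)) (treesOfHeight≤ h K)
           (cartesianProduct K (treesOfHeight≤ h K))

treesOfHeight≤-complete : ∀ h {K} T → height T ≤ h → All (_∈ K) (inorder T) → T ∈ treesOfHeight≤ h K
treesOfHeight≤-complete zero leaf _ _ = here refl
treesOfHeight≤-complete (suc h) leaf _ _ = here refl
treesOfHeight≤-complete (suc h) (node l k r) (s≤s height≤) keys∈
  with keys∈l , k∈ ∷ keys∈r ← All.++⁻ (inorder l) keys∈ =
  there (∈.∈-cartesianProductWith⁺ _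
    (treesOfHeight≤-complete h l (ℕ.m⊔n≤o⇒m≤o _ _ height≤) keys∈l)
    (∈.∈-cartesianProduct⁺ k∈ (treesOfHeight≤-complete h r (ℕ.m⊔n≤o⇒n≤o _ _ height≤) keys∈r)))

IsGex-exists : ∀ n P → ∃[ m ] Attained n P m → ∃[ g ] IsGex n P g
IsGex-exists n P (_ , X₀ , T₀ , perm₀ , avoids₀ , bst₀ , _) =
  maximum (argmax-exists admissible? size candidates complete {X₀ , T₀} (perm₀ , avoids₀ , bst₀))
  where
    Admissible : List ℕ × Tree → Set
    Admissible (X , T) = IsPermOf n X × Avoids X P × IsBSTOn n T
    admissible? : U.Decidable Admissible
    admissible? (X , T) =
      ↭-dec ℕ._≟_ X (range1 n) ×-dec Dec.¬? (Contains-dec X P) ×-dec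
      List.≡-dec ℕ._≟_ (inorder T) (range1 n)
    size : List ℕ × Tree → ℕ
    size (X , T) = length (G n T X)
    candidates : List (List ℕ × Tree)
    candidates = cartesianProduct (listsOfLength n (range1 n)) (treesOfHeight≤ n (range1 n))
    complete : ∀ {c} → Admissible c → c ∈ candidates
    complete {X , T} (perm , _ , bst) = ∈.∈-cartesianProduct⁺
      (subst (λ k → X ∈ listsOfLength k (range1 n)) (trans (↭.↭-length perm) (length-range1 n))
        (listsOfLength-complete X (All.tabulate (↭.∈-resp-↭ perm))))
      (treesOfHeight≤-complete n T
        (subst (height T ≤_) (trans (cong length bst) (length-range1 n)) (height≤size T))
        (subst (All (_∈ range1 n)) (sym bst) (All.tabulate (λ k∈ → k∈))))
    maximum : ∃[ c ] (Admissible c × (∀ {c′} → Admissible c′ → size c′ ≤ size c)) →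
      ∃[ g ] IsGex n P g
    maximum ((X , T) , (perm , avoids , bst) , maximal) =
      size (X , T) , (X , T , perm , avoids , bst , refl) ,
      λ { _ (_ , _ , perm′ , avoids′ , bst′ , refl) → maximal (perm′ , avoids′ , bst′) }

rightComb : List ℕ → Tree
rightComb [] = leaf
rightComb (k ∷ ks) = node leaf k (rightComb ks)

inorder-rightComb : ∀ ks → inorder (rightComb ks) ≡ ks
inorder-rightComb [] = refl
inorder-rightComb (k ∷ ks) = cong (k ∷_) (inorder-rightComb ks)

AllPairs-resp-⊆ : ∀ {A : Set} {R : A → A → Set} {xs ys} → xs ⊆ ys →
  AllPairs R ys → AllPairs R xs
AllPairs-resp-⊆ [] [] = []
AllPairs-resp-⊆ (_ ∷ʳ xs⊆) (_ ∷ pairs) = AllPairs-resp-⊆ xs⊆ pairs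
AllPairs-resp-⊆ (refl ∷ xs⊆) (rel ∷ pairs) =
  Sublist.All-resp-⊆ xs⊆ rel ∷ AllPairs-resp-⊆ xs⊆ pairs

descending-avoids-ascent : ∀ {X a b rest} → a < b → AllPairs (λ u v → v < u) X →
  Avoids X (a ∷ b ∷ rest)
descending-avoids-ascent a<b descending (ys , ys⊆ , iso)
  with iso | AllPairs-resp-⊆ ys⊆ descending
... | ((lt , _) ∷ _) ∷ _ | (y₁<y₀ ∷ _) ∷ _ = ℕ.<-asym y₁<y₀ (Equivalence.from lt a<b)

downFrom-descending : ∀ n → AllPairs (λ u v → v < u) (map suc (downFrom n))
downFrom-descending zero = []
downFrom-descending (suc n) =
  All.map⁺ (All.applyDownFrom⁺₁ (λ i → i) n s≤s) ∷ downFrom-descending n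

downFrom-IsPermOf : ∀ n → IsPermOf n (map suc (downFrom n))
downFrom-IsPermOf n = subst (_↭ range1 n) (sym reversed) (↭.↭-reverse (range1 n))
  where
    reversed : map suc (downFrom n) ≡ reverse (range1 n)
    reversed = trans (cong (map suc) (sym (List.reverse-upTo n))) (List.reverse-map suc (upTo n))

descending-attained : ∀ n {a b rest} → a < b → ∃[ m ] Attained n (a ∷ b ∷ rest) m
descending-attained n a<b =
  _ , map suc (downFrom n) , rightComb (range1 n) , downFrom-IsPermOf n ,
  descending-avoids-ascent a<b (downFrom-descending n) , inorder-rightComb (range1 n) , refl

flipSeq-bounded : ∀ P → All (_≤ suc (length (flipSeq P))) (flipSeq P)
flipSeq-bounded P =
  subst (λ k → All (_≤ suc k) (flipSeq P)) (sym (List.length-map _ P))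
    (Mirror.map-mir-bounded (length P) P)

flipSeq-involutive : ∀ {P} → All (_≤ suc (length P)) P → flipSeq (flipSeq P) ≡ P
flipSeq-involutive {P} P≤ =
  trans (cong (λ k → map (suc k ∸_) (flipSeq P)) (List.length-map _ P))
    (Mirror.map-mir-involutive (length P) P≤)

IsGex-flip : ∀ {n P g} → All (_≤ suc (length P)) P → IsGex n P g → IsGex n (flipSeq P) g
IsGex-flip {n} {P} {g} P≤ (attained , maximal) =
  Mirror.Attained-flip n (flipSeq-bounded P)
    (subst (λ Q → Attained n Q g) (sym (flipSeq-involutive P≤)) attained) ,
  λ m attained′ → maximal m (Mirror.Attained-flip n P≤ attained′)

patterns-attained : ∀ n {P} → P ∈ (P₁ ∷ P₂ ∷ P₃ ∷ []) → ∃[ m ] Attained n P m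
patterns-attained n (here refl) = descending-attained n (from-yes (1 ℕ.<? 2))
patterns-attained n (there (here refl)) = descending-attained n (from-yes (2 ℕ.<? 3))
patterns-attained n (there (there (here refl))) = descending-attained n (from-yes (1 ℕ.<? 3))

patterns-bounded : ∀ {P} → P ∈ (P₁ ∷ P₂ ∷ P₃ ∷ []) → All (_≤ suc (length P)) P
patterns-bounded (here refl) = from-yes (All.all? (ℕ._≤? 4) P₁)
patterns-bounded (there (here refl)) = from-yes (All.all? (ℕ._≤? 4) P₂)
patterns-bounded (there (there (here refl))) = from-yes (All.all? (ℕ._≤? 4) P₃)

mainTheorem5 : (P : List ℕ) → P ∈ (P₁ ∷ P₂ ∷ P₃ ∷ []) → (n : ℕ) →
    ∃[ g ] (IsGex n P g × IsGex n (flipSeq P) g)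
mainTheorem5 P P∈ n with IsGex-exists n P (patterns-attained n P∈)
... | g , isGex = g , isGex , IsGex-flip (patterns-bounded P∈) isGex
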